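{- Let $P=(E,\rho)$ be a $(q,r)$-polymatroid with $E=\mathbb{F}_q^n$, and let $P^*=(E,\rho^*)$ be its dual, where $\rho^*(J):=\rho(J^{\perp})+r\dim J-\rho(E)$. Then, as polynomials in $X_1,X_2,X_3,X_4$, $$R_{P^*}(X_1,X_2,X_3,X_4)=\widehat{R}_{P}(X_2,X_1,X_3,X_4).$$
   Context: $q$ is a prime power, $n,r$ positive integers; $\Sigma(E)$ is the set of all $\mathbb{F}_q$-subspaces of $E$; $J^{\perp}$ is the orthogonal complement of $J$ for the standard dot product on $\mathbb{F}_q^n$. A $(q,r)$-polymatroid is a pair $(E,\rho)$ with $\rho:\Sigma(E)\to\mathbb{Z}_{\ge0}$ such that (R1) $0\le\rho(A)\le r\dim A$; (R2) $A\subseteq B\Rightarrow\rho(A)\le\rho(B)$; (R3) $\rho(A+B)+\rho(A\cap B)\le\rho(A)+\rho(B)$ (it is known that $P^*$ is again a $(q,r)$-polymatroid). For a $(q,r)$-polymatroid $P=(E,\rho)$ and $J\in\Sigma(E)$ put $f_P^J(X,Y):=X^{\rho(E)-\rho(J)}Y^{r\dim J-\rho(J)}$, and for an integer $l\ge0$ put $g^l(X,Y):=\prod_{i=0}^{l-1}(X-q^iY)$ (empty product $=1$). The rank generating function is $R_P(X_1,X_2,X_3,X_4):=\sum_{D\in\Sigma(E)}f_P^D(X_1,X_2)\,g^{\dim D}(X_3,X_4)$, and $\widehat{R}_P(X_1,X_2,X_3,X_4):=\sum_{D\in\Sigma(E)}f_P^D(X_1,X_2)\,g^{\dim D^{\perp}}(X_3,X_4)$.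 -}

module Defs where

open import Level using (0ℓ)
open import Data.Bool using (Bool; true; false; _∧_; _∨_; not; if_then_else_)
open import Data.Bool.ListAction using (all; any)
open import Data.Nat as ℕ using (ℕ; zero; suc; _∸_; _≤_)
open import Data.Integer as ℤ using (ℤ; +_)
open import Data.List as List using (List; []; _∷_; length; concatMap; filterᵇ)
open import Data.List.Membership.Propositional using (_∈_)
open import Data.List.Relation.Unary.Unique.Propositional using (Unique)
open import Data.Vec as Vec using (Vec; []; _∷_)
import Data.Vec.Properties as VecP
open import Relation.Nullary using (¬_)
open import Relation.Nullary.Decidable using (⌊_⌋)
open import Relation.Binary.Definitions using (DecidableEquality)
open import Relation.Binary.PropositionalEquality using (_≡_)
open import Algebra.Structures using (IsCommutativeRing)

record FiniteField : Set₁ where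
  field
    Carrier : Set
    _+_ _*_ : Carrier → Carrier → Carrier
    -_      : Carrier → Carrier
    0# 1#   : Carrier
    isCommutativeRing : IsCommutativeRing _≡_ _+_ _*_ -_ 0# 1#
    0≢1     : ¬ (0# ≡ 1#)
    _⁻¹     : Carrier → Carrier
    inverse : ∀ x → ¬ (x ≡ 0#) → (x * (x ⁻¹)) ≡ 1#
    _≟_     : DecidableEquality Carrier
    elements : List Carrier
    complete : ∀ x → x ∈ elements
    unique   : Unique elements

  q : ℕ
  q = length elements

module Poly (𝔽 : FiniteField) (n r : ℕ) where
  open FiniteField 𝔽

  vecs : (m : ℕ) → List (Vec Carrier m)
  vecs zero    = [] ∷ []
  vecs (suc m) = concatMap (λ x → List.map (x ∷_) (vecs m)) elements

  allE : List (Vec Carrier n)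
  allE = vecs n

  N : ℕ
  N = length allE

  allEᵛ : Vec (Vec Carrier n) N
  allEᵛ = Vec.fromList allE

  _≟ᵛ_ : DecidableEquality (Vec Carrier n)
  _≟ᵛ_ = VecP.≡-dec _≟_

  _+ᵛ_ : Vec Carrier n → Vec Carrier n → Vec Carrier n
  _+ᵛ_ = Vec.zipWith _+_

  _·ᵛ_ : Carrier → Vec Carrier n → Vec Carrier n
  a ·ᵛ v = Vec.map (a *_) v

  0ᵛ : Vec Carrier n
  0ᵛ = Vec.replicate n 0#

  dot : Vec Carrier n → Vec Carrier n → Carrier
  dot u v = Vec.foldr _ _+_ 0# (Vec.zipWith _*_ u v)

  -- A subset of E: its characteristic vector w.r.t. the listing allEᵛ
  SubE : Set
  SubE = Vec Bool N

  memAt : ∀ {m} → Vec Bool m → Vec (Vec Carrier n) m → Vec Carrier n → Bool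
  memAt []       []       v = false
  memAt (b ∷ bs) (u ∷ us) v = if ⌊ u ≟ᵛ v ⌋ then b else memAt bs us v

  _∈ₛ_ : Vec Carrier n → SubE → Bool
  v ∈ₛ S = memAt S allEᵛ v

  fromPred : (Vec Carrier n → Bool) → SubE
  fromPred p = Vec.map p allEᵛ

  boolVecs : (m : ℕ) → List (Vec Bool m)
  boolVecs zero    = [] ∷ []
  boolVecs (suc m) = concatMap (λ b → List.map (b ∷_) (boolVecs m)) (true ∷ false ∷ [])

  isSubspace : SubE → Bool
  isSubspace S =
    (0ᵛ ∈ₛ S)
    ∧ all (λ u → all (λ v → not (u ∈ₛ S) ∨ not (v ∈ₛ S) ∨ ((u +ᵛ v) ∈ₛ S)) allE) allE
    ∧ all (λ a → all (λ v → not (v ∈ₛ S) ∨ ((a ·ᵛ v) ∈ₛ S)) allE) elements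

  ΣE : List SubE
  ΣE = filterᵇ isSubspace (boolVecs N)

  Eₛ : SubE
  Eₛ = Vec.replicate N true

  _⊆ₛ_ : SubE → SubE → Set
  A ⊆ₛ B = ∀ v → (v ∈ₛ A) ≡ true → (v ∈ₛ B) ≡ true

  _∩ₛ_ : SubE → SubE → SubE
  A ∩ₛ B = Vec.zipWith _∧_ A B

  _+ₛ_ : SubE → SubE → SubE
  A +ₛ B = fromPred (λ w → any (λ a → any (λ b →
             (a ∈ₛ A) ∧ (b ∈ₛ B) ∧ ⌊ (a +ᵛ b) ≟ᵛ w ⌋) allE) allE)

  _⊥ : SubE → SubE
  J ⊥ = fromPred (λ v → all (λ u → not (u ∈ₛ J) ∨ ⌊ dot v u ≟ 0# ⌋) allE)

  card : ∀ {m} → Vec Bool m → ℕ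
  card []           = 0
  card (true ∷ bs)  = suc (card bs)
  card (false ∷ bs) = card bs

  -- dimension of a subspace D: the d (0 ≤ d ≤ n) with |D| = q^d
  logq : ℕ → ℕ → ℕ
  logq c zero    = 0
  logq c (suc k) = if ⌊ q ℕ.^ (suc k) ℕ.≟ c ⌋ then suc k else logq c k

  dim : SubE → ℕ
  dim D = logq (card D) n

  record Polymatroid : Set where
    field
      ρ  : SubE → ℕ
      R1 : ∀ A → isSubspace A ≡ true → ρ A ≤ r ℕ.* dim A
      R2 : ∀ A B → isSubspace A ≡ true → isSubspace B ≡ true →
           A ⊆ₛ B → ρ A ≤ ρ B
      R3 : ∀ A B → isSubspace A ≡ true → isSubspace B ≡ true →
           ρ (A +ₛ B) ℕ.+ ρ (A ∩ₛ B) ≤ ρ A ℕ.+ ρ B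

  dualρ : (SubE → ℕ) → SubE → ℕ
  dualρ ρ J = (ρ (J ⊥) ℕ.+ r ℕ.* dim J) ∸ ρ Eₛ

  f : (SubE → ℕ) → SubE → ℤ → ℤ → ℤ
  f ρ J X Y = (X ℤ.^ (ρ Eₛ ∸ ρ J)) ℤ.* (Y ℤ.^ (r ℕ.* dim J ∸ ρ J))

  g : ℕ → ℤ → ℤ → ℤ
  g zero    X Y = ℤ.+ 1
  g (suc l) X Y = g l X Y ℤ.* (X ℤ.- ((+ (q ℕ.^ l)) ℤ.* Y))

  sumℤ : List ℤ → ℤ
  sumℤ = List.foldr ℤ._+_ (ℤ.+ 0)

  -- rank generating function R_P, evaluated at integers
  RGF : (SubE → ℕ) → ℤ → ℤ → ℤ → ℤ → ℤ
  RGF ρ X₁ X₂ X₃ X₄ = sumℤ (List.map (λ D → f ρ D X₁ X₂ ℤ.* g (dim D) X₃ X₄) ΣE)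

  RGFhat : (SubE → ℕ) → ℤ → ℤ → ℤ → ℤ → ℤ
  RGFhat ρ X₁ X₂ X₃ X₄ = sumℤ (List.map (λ D → f ρ D X₁ X₂ ℤ.* g (dim (D ⊥)) X₃ X₄) ΣE)

-- For a subspace D put e = ρ(E), s = ρ(D⊥), a = r·dim D and b = r·dim D⊥.  Then
-- ρ*(D) = s + a − e and ρ*(E) = a + b − e, so f_{P*}^D(X,Y) = X^{b−s} Y^{e−s} = f_P^{D⊥}(Y,X);
-- together with dim D = dim D⊥⊥ this makes the D-term of R_{P*}(X₁,X₂,X₃,X₄) the D⊥-term of
-- R̂_P(X₂,X₁,X₃,X₄), and D ↦ D⊥ permutes Σ(E).
--
-- The linear algebra behind this (D⊥⊥ = D and |D|·|D⊥| = qⁿ, hence dim D + dim D⊥ = n) is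
-- proved by growing D from 0 one vector v ∉ D at a time.  Every x ∈ D + 𝔽v meets D in exactly
-- one point of its line x + 𝔽v, and for w ∈ D⊥ with w·v ≠ 0 every x ∈ D⊥ meets (D + 𝔽v)⊥ in
-- exactly one point of x + 𝔽w; so the step multiplies |D| and divides |D⊥| by q.  Finally the
-- truncated subtraction in ρ* is exact because e ≤ s + a, by submodularity: adding one vector
-- to a subspace raises ρ by at most r.

module Submission where

open import Defs
open import Data.Bool using (Bool; true; false; T; not; _∨_; if_then_else_)
open import Data.Bool.Properties using (T-∧; T-≡)
open import Data.Bool.ListAction using (all; any)
open import Data.Empty using (⊥-elim)
open import Data.Nat as ℕ using (ℕ; zero; suc; _∸_; _≤_; _<_)
import Data.Nat.Properties as ℕₚ
open import Data.Integer as ℤ using (ℤ)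
import Data.Integer.Properties as ℤₚ
open import Data.List as List using (List; []; _∷_; foldr; map; length; concatMap; cartesianProductWith)
import Data.List.Properties as Listₚ
open import Data.List.Membership.Propositional using (_∈_; find; lose)
open import Data.List.Membership.Propositional.Properties using (∈-filter⁺; ∈-filter⁻; ∈-cartesianProductWith⁺; ∈-map⁻; ∈-map⁺)
open import Data.List.Membership.Propositional.Properties.WithK using (unique∧set⇒bag)
open import Data.List.Relation.Binary.BagAndSetEquality using (∼bag⇒↭)
open import Data.List.Relation.Binary.Permutation.Propositional using (_↭_; ↭⇒↭ₛ)
import Data.List.Relation.Binary.Permutation.Propositional.Properties as ↭
import Data.List.Relation.Binary.Permutation.Setoid.Properties as ↭ₛ
open import Data.List.Relation.Unary.All using (All; []; _∷_)
import Data.List.Relation.Unary.All as All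
import Data.List.Relation.Unary.All.Properties as All
open import Data.List.Relation.Unary.Any using (here; there; any?)
import Data.List.Relation.Unary.Any.Properties as Any
open import Data.List.Relation.Unary.Unique.Propositional using (Unique; []; _∷_)
import Data.List.Relation.Unary.Unique.Propositional.Properties as Unique
open import Data.Product using (_×_; _,_; ∃-syntax; proj₁; proj₂)
open import Data.Vec as Vec using (Vec; []; _∷_)
import Data.Vec.Properties as Vecₚ
open import Function using (_∘_; _⇔_; mk⇔; Equivalence)
open Equivalence using (to; from)
open import Level using (0ℓ)
open import Algebra.Bundles using (CommutativeMonoid; CommutativeRing)
open import Algebra.Core using (Op₁; Op₂)
open import Algebra.Structures using (IsCommutativeMonoid; IsCommutativeRing)
open import Relation.Binary.Definitions using (DecidableEquality)
open import Relation.Binary.PropositionalEquality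
  using (_≡_; _≢_; refl; sym; trans; cong; cong₂; subst; subst₂; setoid; module ≡-Reasoning)
open import Relation.Nullary using (¬_; yes; no; contradiction)
open import Relation.Nullary.Decidable using (Dec; T?; ⌊_⌋; toWitness; fromWitness; map′; _×-dec_; ¬?; decidable-stable)

-- Finite sums and counting over lists

module FiniteSum {M : Set} {_∙_ : M → M → M} {ε : M}
                 (isCM : IsCommutativeMonoid _≡_ _∙_ ε) where
  open IsCommutativeMonoid isCM using (identityˡ)
  open ≡-Reasoning

  commutativeMonoid : CommutativeMonoid 0ℓ 0ℓ
  commutativeMonoid = record { isCommutativeMonoid = isCM }

  open import Algebra.Properties.CommutativeSemigroup (CommutativeMonoid.commutativeSemigroup commutativeMonoid)
    using (interchange)

  ∑ : {A : Set} → (A → M) → List A → M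
  ∑ f xs = foldr _∙_ ε (map f xs)

  module _ {A : Set} where

    ∑-cong : ∀ {f g : A → M} xs → (∀ {x} → x ∈ xs → f x ≡ g x) → ∑ f xs ≡ ∑ g xs
    ∑-cong []       eq = refl
    ∑-cong (x ∷ xs) eq = cong₂ _∙_ (eq (here refl)) (∑-cong xs (eq ∘ there))

    ∑-map : ∀ {B : Set} (f : B → M) (h : A → B) xs → ∑ f (map h xs) ≡ ∑ (f ∘ h) xs
    ∑-map f h []       = refl
    ∑-map f h (x ∷ xs) = cong (f (h x) ∙_) (∑-map f h xs)

    ∑-ε : ∀ (xs : List A) → ∑ (λ _ → ε) xs ≡ ε
    ∑-ε []       = refl
    ∑-ε (x ∷ xs) = trans (identityˡ _) (∑-ε xs)

    ∑-distrib : ∀ (f g : A → M) xs → ∑ (λ x → f x ∙ g x) xs ≡ ∑ f xs ∙ ∑ g xs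
    ∑-distrib f g []       = sym (identityˡ ε)
    ∑-distrib f g (x ∷ xs) = begin
      (f x ∙ g x) ∙ ∑ (λ x → f x ∙ g x) xs ≡⟨ cong ((f x ∙ g x) ∙_) (∑-distrib f g xs) ⟩
      (f x ∙ g x) ∙ (∑ f xs ∙ ∑ g xs)      ≡⟨ interchange (f x) (g x) (∑ f xs) (∑ g xs) ⟩
      (f x ∙ ∑ f xs) ∙ (g x ∙ ∑ g xs)      ∎

    ∑-↭ : ∀ (f : A → M) {xs ys} → xs ↭ ys → ∑ f xs ≡ ∑ f ys
    ∑-↭ f p = ↭ₛ.foldr-commMonoid (setoid M) isCM (↭⇒↭ₛ (↭.map⁺ f p))

  ∑-comm : ∀ {A B : Set} (f : A → B → M) xs ys →
           ∑ (λ x → ∑ (f x) ys) xs ≡ ∑ (λ y → ∑ (λ x → f x y) xs) ys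
  ∑-comm f []       ys = sym (∑-ε ys)
  ∑-comm f (x ∷ xs) ys = trans (cong (∑ (f x) ys ∙_) (∑-comm f xs ys))
                               (sym (∑-distrib (f x) (λ y → ∑ (λ x → f x y) xs) ys))

module _ {A : Set} where

  unique∧same-members⇒↭ : ∀ {xs ys : List A} → Unique xs → Unique ys →
                          (∀ {x} → x ∈ xs → x ∈ ys) → (∀ {x} → x ∈ ys → x ∈ xs) → xs ↭ ys
  unique∧same-members⇒↭ uxs uys to from = ∼bag⇒↭ (unique∧set⇒bag uxs uys (mk⇔ to from))

  Unique-map⁺ : ∀ {B : Set} {f : A → B} {xs} →
                (∀ {x y} → x ∈ xs → y ∈ xs → f x ≡ f y → x ≡ y) → Unique xs → Unique (map f xs)
  Unique-map⁺ {xs = []}     inj []           = []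
  Unique-map⁺ {xs = x ∷ xs} inj (x∉xs ∷ uxs) =
    All.map⁺ (All.tabulate λ y∈ fx≡fy → All.lookup x∉xs y∈ (inj (here refl) (there y∈) fx≡fy))
    ∷ Unique-map⁺ (λ x∈ y∈ → inj (there x∈) (there y∈)) uxs

  map-fromList-cong : ∀ {B : Set} {f g : A → B} L → (∀ {x} → x ∈ L → f x ≡ g x) →
                      Vec.map f (Vec.fromList L) ≡ Vec.map g (Vec.fromList L)
  map-fromList-cong []      eq = refl
  map-fromList-cong (x ∷ L) eq = cong₂ _∷_ (eq (here refl)) (map-fromList-cong L (eq ∘ there))

  distinct-members⇒2≤length : ∀ {x y : A} {xs} → x ∈ xs → y ∈ xs → x ≢ y → 2 ≤ length xs
  distinct-members⇒2≤length {xs = _ ∷ []}    (here refl) (here refl) x≢y = contradiction refl x≢y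
  distinct-members⇒2≤length {xs = _ ∷ _ ∷ _} _           _           _   = ℕ.s≤s (ℕ.s≤s ℕ.z≤n)

T-injective : ∀ {x y} → (T x → T y) → (T y → T x) → x ≡ y
T-injective {true}  {true}  _ _ = refl
T-injective {true}  {false} f _ = ⊥-elim (f _)
T-injective {false} {true}  _ g = ⊥-elim (g _)
T-injective {false} {false} _ _ = refl

T-⇒ : ∀ {x y} → T (not x ∨ y) ⇔ (T x → T y)
T-⇒ {true}  = mk⇔ (λ y _ → y) (λ f → f _)
T-⇒ {false} = mk⇔ (λ _ ()) (λ _ → _)

module _ {A : Set} {xs : List A} (complete : ∀ x → x ∈ xs) (p : A → Bool) where

  T-all : T (all p xs) ⇔ (∀ x → T (p x))
  T-all = mk⇔ (λ t x → All.lookup (All.all⁺ p xs t) (complete x))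
              (λ h → All.all⁻ p (All.tabulate {xs = xs} (λ {x} _ → h x)))

  T-any : T (any p xs) ⇔ (∃[ x ] T (p x))
  T-any = mk⇔ (λ t → let x , _ , px = find (Any.any⁻ p xs t) in x , px)
              (λ (x , px) → Any.any⁺ p (lose (complete x) px))

  ¬T-all : ¬ T (all p xs) → ∃[ x ] ¬ T (p x)
  ¬T-all ¬all = let x , _ , ¬px = find (All.¬All⇒Any¬ (T? ∘ p) xs (¬all ∘ All.all⁻ p)) in x , ¬px

module ℕ-Sum = FiniteSum ℕₚ.+-0-isCommutativeMonoid
module ℤ-Sum = FiniteSum ℤₚ.+-0-isCommutativeMonoid

indicator : Bool → ℕ
indicator true  = 1
indicator false = 0

module Counting {A : Set} where
  open ℕ-Sum using (∑)

  count : (A → Bool) → List A → ℕ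
  count p = ∑ (indicator ∘ p)

  ∑-const : ∀ c (xs : List A) → ∑ (λ _ → c) xs ≡ length xs ℕ.* c
  ∑-const c []       = refl
  ∑-const c (x ∷ xs) = cong (c ℕ.+_) (∑-const c xs)

  count-≡0 : ∀ p xs → (∀ {x} → x ∈ xs → ¬ T (p x)) → count p xs ≡ 0
  count-≡0 p []       none = refl
  count-≡0 p (x ∷ xs) none with p x in eq
  ... | true  = contradiction (subst T (sym eq) _) (none (here refl))
  ... | false = count-≡0 p xs (none ∘ there)

  count-pos : ∀ p {a} xs → a ∈ xs → T (p a) → 1 ≤ count p xs
  count-pos p (x ∷ xs) (here refl) pa with p x
  ... | true = ℕ.s≤s ℕ.z≤n
  count-pos p (x ∷ xs) (there a∈) pa = ℕₚ.≤-trans (count-pos p xs a∈ pa) (ℕₚ.m≤n+m _ (indicator (p x)))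

  count-≡1 : ∀ p {a} xs → Unique xs → a ∈ xs → T (p a) → (∀ {x} → x ∈ xs → T (p x) → x ≡ a) →
             count p xs ≡ 1
  count-≡1 p (x ∷ xs) (x∉xs ∷ uxs) a∈ pa only with p x in eq
  ... | true  = cong suc (count-≡0 p xs λ y∈ py →
                  All.lookup x∉xs y∈ (trans (only (here refl) (subst T (sym eq) _)) (sym (only (there y∈) py))))
  ... | false with a∈
  ...   | here refl = contradiction (subst T eq pa) λ ()
  ...   | there a∈xs = count-≡1 p xs uxs a∈xs pa (only ∘ there)

IsEnumeration : {A : Set} → List A → Set
IsEnumeration xs = Unique xs × (∀ x → x ∈ xs)

module _ {X : Set} {m : ℕ} where

  consAll : List X → List (Vec X m) → List (Vec X (suc m))
  consAll xs vs = concatMap (λ x → map (x ∷_) vs) xs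

  consAll≡cartesianProductWith : ∀ xs vs → consAll xs vs ≡ cartesianProductWith _∷_ xs vs
  consAll≡cartesianProductWith []       vs = refl
  consAll≡cartesianProductWith (x ∷ xs) vs = cong (map (x ∷_) vs List.++_) (consAll≡cartesianProductWith xs vs)

  consAll-enumeration : ∀ {xs vs} → IsEnumeration xs → IsEnumeration vs → IsEnumeration (consAll xs vs)
  consAll-enumeration {xs} {vs} (uxs , xs-complete) (uvs , vs-complete) rewrite consAll≡cartesianProductWith xs vs =
    Unique.cartesianProductWith⁺ _∷_ Vecₚ.∷-injective uxs uvs ,
    λ { (x ∷ v) → ∈-cartesianProductWith⁺ _∷_ (xs-complete x) (vs-complete v) }

  length-consAll : ∀ xs vs → length (consAll xs vs) ≡ length xs ℕ.* length vs
  length-consAll []       vs = refl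
  length-consAll (x ∷ xs) vs = begin
    length (map (x ∷_) vs List.++ consAll xs vs)     ≡⟨ Listₚ.length-++ (map (x ∷_) vs) ⟩
    length (map (x ∷_) vs) ℕ.+ length (consAll xs vs) ≡⟨ cong₂ ℕ._+_ (Listₚ.length-map (x ∷_) vs) (length-consAll xs vs) ⟩
    length vs ℕ.+ length xs ℕ.* length vs             ∎
    where open ≡-Reasoning

^-cancelʳ-≤ : ∀ {m a b} → 1 < m → m ℕ.^ a ≤ m ℕ.^ b → a ≤ b
^-cancelʳ-≤ {m} 1<m le = ℕₚ.≮⇒≥ λ b<a → ℕₚ.<⇒≱ (ℕₚ.^-monoʳ-< m 1<m b<a) le

^-injectiveʳ : ∀ {m a b} → 1 < m → m ℕ.^ a ≡ m ℕ.^ b → a ≡ b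
^-injectiveʳ 1<m eq = ℕₚ.≤-antisym (^-cancelʳ-≤ 1<m (ℕₚ.≤-reflexive eq)) (^-cancelʳ-≤ 1<m (ℕₚ.≤-reflexive (sym eq)))

[m∸o]∸[n∸o]≡m∸n : ∀ m {n o} → o ≤ n → (m ∸ o) ∸ (n ∸ o) ≡ m ∸ n
[m∸o]∸[n∸o]≡m∸n m {n} {o} o≤n = trans (ℕₚ.∸-+-assoc m o (n ∸ o)) (cong (m ∸_) (ℕₚ.m+[n∸m]≡n o≤n))

m∸[[n+m]∸o]≡o∸n : ∀ {m n o} → n ≤ o → o ≤ n ℕ.+ m → m ∸ ((n ℕ.+ m) ∸ o) ≡ o ∸ n
m∸[[n+m]∸o]≡o∸n {m} {n} {o} n≤o o≤n+m = begin
  m ∸ ((n ℕ.+ m) ∸ o)         ≡⟨ cong (λ x → m ∸ ((n ℕ.+ m) ∸ x)) (ℕₚ.m+[n∸m]≡n n≤o) ⟨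
  m ∸ ((n ℕ.+ m) ∸ (n ℕ.+ k)) ≡⟨ cong (m ∸_) (ℕₚ.[m+n]∸[m+o]≡n∸o n m k) ⟩
  m ∸ (m ∸ k)                 ≡⟨ ℕₚ.m∸[m∸n]≡n k≤m ⟩
  k                           ∎
  where
  open ≡-Reasoning
  k = o ∸ n
  k≤m : k ≤ m
  k≤m = ℕₚ.+-cancelˡ-≤ n k m (subst (_≤ n ℕ.+ m) (sym (ℕₚ.m+[n∸m]≡n n≤o)) o≤n+m)

-- Vectors over a commutative ring

module VectorAlgebra {R : Set} {add mul : Op₂ R} {neg : Op₁ R} {0r 1r : R}
                     (isCR : IsCommutativeRing _≡_ add mul neg 0r 1r) where
  commutativeRing : CommutativeRing 0ℓ 0ℓ
  commutativeRing = record { isCommutativeRing = isCR }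

  open CommutativeRing commutativeRing
    using (_+_; _*_; -_; 0#; 1#; +-assoc; +-identityˡ; +-identityʳ; -‿inverseˡ; -‿inverseʳ;
           *-assoc; *-comm; *-identityʳ; *-identityˡ; zeroˡ; zeroʳ; distribˡ; distribʳ)
  open import Algebra.Properties.Ring (CommutativeRing.ring commutativeRing)
    using (-1*x≈-x; -‿+-comm; -‿distribˡ-*)
  open import Algebra.Properties.CommutativeSemigroup (CommutativeRing.+-commutativeSemigroup commutativeRing)
    using (interchange)
  open ≡-Reasoning

  infixl 6 _+ᵛ_
  infixr 7 _·ᵛ_

  -- The vector operations of `Poly`, for every length: `Poly`'s operations unfold to these,
  -- so the lemmas below apply to them.

  _+ᵛ_ : ∀ {m} → Vec R m → Vec R m → Vec R m
  _+ᵛ_ = Vec.zipWith _+_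

  _·ᵛ_ : ∀ {m} → R → Vec R m → Vec R m
  a ·ᵛ v = Vec.map (a *_) v

  0ᵛ : ∀ {m} → Vec R m
  0ᵛ {m} = Vec.replicate m 0#

  dot : ∀ {m} → Vec R m → Vec R m → R
  dot u v = Vec.foldr _ _+_ 0# (Vec.zipWith _*_ u v)

  private variable m : ℕ

  +ᵛ-assoc : ∀ (x y z : Vec R m) → (x +ᵛ y) +ᵛ z ≡ x +ᵛ (y +ᵛ z)
  +ᵛ-assoc = Vecₚ.zipWith-assoc +-assoc

  +ᵛ-identityˡ : ∀ (x : Vec R m) → 0ᵛ +ᵛ x ≡ x
  +ᵛ-identityˡ = Vecₚ.zipWith-identityˡ +-identityˡ

  +ᵛ-identityʳ : ∀ (x : Vec R m) → x +ᵛ 0ᵛ ≡ x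
  +ᵛ-identityʳ = Vecₚ.zipWith-identityʳ +-identityʳ

  +ᵛ-interchange : ∀ (u w u′ w′ : Vec R m) → (u +ᵛ w) +ᵛ (u′ +ᵛ w′) ≡ (u +ᵛ u′) +ᵛ (w +ᵛ w′)
  +ᵛ-interchange []       []       []       []         = refl
  +ᵛ-interchange (a ∷ u) (b ∷ w) (c ∷ u′) (d ∷ w′) =
    cong₂ _∷_ (interchange a b c d) (+ᵛ-interchange u w u′ w′)

  ·ᵛ-assoc : ∀ a b (z : Vec R m) → a ·ᵛ b ·ᵛ z ≡ (a * b) ·ᵛ z
  ·ᵛ-assoc a b z = trans (sym (Vecₚ.map-∘ (a *_) (b *_) z)) (Vecₚ.map-cong (λ x → sym (*-assoc a b x)) z)

  ·ᵛ-identityˡ : ∀ (z : Vec R m) → 1# ·ᵛ z ≡ z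
  ·ᵛ-identityˡ z = trans (Vecₚ.map-cong *-identityˡ z) (Vecₚ.map-id z)

  ·ᵛ-zeroˡ : ∀ (z : Vec R m) → 0# ·ᵛ z ≡ 0ᵛ
  ·ᵛ-zeroˡ z = trans (Vecₚ.map-cong zeroˡ z) (Vecₚ.map-const z 0#)

  ·ᵛ-zeroʳ : ∀ {m} a → a ·ᵛ 0ᵛ {m} ≡ 0ᵛ
  ·ᵛ-zeroʳ {m} a = trans (Vecₚ.map-replicate (a *_) 0# m) (cong (Vec.replicate m) (zeroʳ a))

  ·ᵛ-distribˡ : ∀ a (u w : Vec R m) → a ·ᵛ (u +ᵛ w) ≡ a ·ᵛ u +ᵛ a ·ᵛ w
  ·ᵛ-distribˡ a []      []      = refl
  ·ᵛ-distribˡ a (x ∷ u) (y ∷ w) = cong₂ _∷_ (distribˡ a x y) (·ᵛ-distribˡ a u w)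

  ·ᵛ-distribʳ : ∀ a b (z : Vec R m) → a ·ᵛ z +ᵛ b ·ᵛ z ≡ (a + b) ·ᵛ z
  ·ᵛ-distribʳ a b []      = refl
  ·ᵛ-distribʳ a b (x ∷ z) = cong₂ _∷_ (sym (distribʳ x a b)) (·ᵛ-distribʳ a b z)

  +ᵛ-·ᵛ-merge : ∀ (x z : Vec R m) a b → x +ᵛ a ·ᵛ z +ᵛ b ·ᵛ z ≡ x +ᵛ (a + b) ·ᵛ z
  +ᵛ-·ᵛ-merge x z a b = trans (+ᵛ-assoc x _ _) (cong (x +ᵛ_) (·ᵛ-distribʳ a b z))

  +ᵛ-·ᵛ-inverseʳ : ∀ (x z : Vec R m) c → x +ᵛ c ·ᵛ z +ᵛ (- c) ·ᵛ z ≡ x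
  +ᵛ-·ᵛ-inverseʳ x z c = begin
    x +ᵛ c ·ᵛ z +ᵛ (- c) ·ᵛ z ≡⟨ +ᵛ-·ᵛ-merge x z c (- c) ⟩
    x +ᵛ (c + - c) ·ᵛ z       ≡⟨ cong (λ a → x +ᵛ a ·ᵛ z) (-‿inverseʳ c) ⟩
    x +ᵛ 0# ·ᵛ z              ≡⟨ cong (x +ᵛ_) (·ᵛ-zeroˡ z) ⟩
    x +ᵛ 0ᵛ                   ≡⟨ +ᵛ-identityʳ x ⟩
    x                         ∎

  +ᵛ-·ᵛ-inverseˡ : ∀ (x z : Vec R m) c → x +ᵛ (- c) ·ᵛ z +ᵛ c ·ᵛ z ≡ x
  +ᵛ-·ᵛ-inverseˡ x z c = begin
    x +ᵛ (- c) ·ᵛ z +ᵛ c ·ᵛ z ≡⟨ +ᵛ-·ᵛ-merge x z (- c) c ⟩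
    x +ᵛ (- c + c) ·ᵛ z       ≡⟨ cong (λ a → x +ᵛ a ·ᵛ z) (-‿inverseˡ c) ⟩
    x +ᵛ 0# ·ᵛ z              ≡⟨ cong (x +ᵛ_) (·ᵛ-zeroˡ z) ⟩
    x +ᵛ 0ᵛ                   ≡⟨ +ᵛ-identityʳ x ⟩
    x                         ∎

  ·ᵛ-line-difference : ∀ (x z : Vec R m) c c′ → x +ᵛ c ·ᵛ z +ᵛ (- 1#) ·ᵛ (x +ᵛ c′ ·ᵛ z) ≡ (c + - c′) ·ᵛ z
  ·ᵛ-line-difference []      []      c c′ = refl
  ·ᵛ-line-difference (x ∷ xs) (z ∷ zs) c c′ = cong₂ _∷_ scalar (·ᵛ-line-difference xs zs c c′)
    where
    scalar : x + c * z + - 1# * (x + c′ * z) ≡ (c + - c′) * z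
    scalar = begin
      x + c * z + - 1# * (x + c′ * z) ≡⟨ cong (x + c * z +_) (-1*x≈-x (x + c′ * z)) ⟩
      x + c * z + - (x + c′ * z)      ≡⟨ cong (x + c * z +_) (sym (-‿+-comm x (c′ * z))) ⟩
      x + c * z + (- x + - (c′ * z))  ≡⟨ interchange x (c * z) (- x) (- (c′ * z)) ⟩
      x + - x + (c * z + - (c′ * z))  ≡⟨ cong₂ _+_ (-‿inverseʳ x) (cong (c * z +_) (-‿distribˡ-* c′ z)) ⟩
      0# + (c * z + - c′ * z)         ≡⟨ +-identityˡ _ ⟩
      c * z + - c′ * z                ≡⟨ sym (distribʳ z c (- c′)) ⟩
      (c + - c′) * z                  ∎

  dot-+ᵛˡ : ∀ (x y u : Vec R m) → dot (x +ᵛ y) u ≡ dot x u + dot y u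
  dot-+ᵛˡ []      []      []      = sym (+-identityʳ 0#)
  dot-+ᵛˡ (a ∷ x) (b ∷ y) (c ∷ u) = begin
    (a + b) * c + dot (x +ᵛ y) u          ≡⟨ cong₂ _+_ (distribʳ c a b) (dot-+ᵛˡ x y u) ⟩
    (a * c + b * c) + (dot x u + dot y u) ≡⟨ interchange (a * c) (b * c) (dot x u) (dot y u) ⟩
    (a * c + dot x u) + (b * c + dot y u) ∎

  dot-·ᵛˡ : ∀ a (x u : Vec R m) → dot (a ·ᵛ x) u ≡ a * dot x u
  dot-·ᵛˡ a []      []      = sym (zeroʳ a)
  dot-·ᵛˡ a (b ∷ x) (c ∷ u) = begin
    a * b * c + dot (a ·ᵛ x) u   ≡⟨ cong₂ _+_ (*-assoc a b c) (dot-·ᵛˡ a x u) ⟩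
    a * (b * c) + a * dot x u    ≡⟨ sym (distribˡ a (b * c) (dot x u)) ⟩
    a * (b * c + dot x u)        ∎

  dot-lineˡ : ∀ (x w u : Vec R m) c → dot (x +ᵛ c ·ᵛ w) u ≡ dot x u + c * dot w u
  dot-lineˡ x w u c = trans (dot-+ᵛˡ x (c ·ᵛ w) u) (cong (dot x u +_) (dot-·ᵛˡ c w u))

  dot-comm : ∀ (x u : Vec R m) → dot x u ≡ dot u x
  dot-comm []      []      = refl
  dot-comm (a ∷ x) (b ∷ u) = cong₂ _+_ (*-comm a b) (dot-comm x u)

  dot-lineʳ : ∀ (u x w : Vec R m) c → dot u (x +ᵛ c ·ᵛ w) ≡ dot u x + c * dot u w
  dot-lineʳ u x w c = begin
    dot u (x +ᵛ c ·ᵛ w)        ≡⟨ dot-comm u _ ⟩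
    dot (x +ᵛ c ·ᵛ w) u        ≡⟨ dot-lineˡ x w u c ⟩
    dot x u + c * dot w u      ≡⟨ cong₂ (λ s t → s + c * t) (dot-comm x u) (dot-comm w u) ⟩
    dot u x + c * dot u w      ∎

  dot-zeroˡ : ∀ (u : Vec R m) → dot 0ᵛ u ≡ 0#
  dot-zeroˡ []      = refl
  dot-zeroˡ (c ∷ u) = trans (cong₂ _+_ (zeroˡ c) (dot-zeroˡ u)) (+-identityʳ 0#)

  dot-zeroʳ : ∀ (u : Vec R m) → dot u 0ᵛ ≡ 0#
  dot-zeroʳ []      = refl
  dot-zeroʳ (c ∷ u) = trans (cong₂ _+_ (zeroʳ c) (dot-zeroʳ u)) (+-identityʳ 0#)

  dot-nondegenerate : DecidableEquality R → ∀ (v : Vec R m) → v ≢ 0ᵛ → ∃[ u ] dot v u ≢ 0#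
  dot-nondegenerate _≟_ []      v≢0 = contradiction refl v≢0
  dot-nondegenerate _≟_ (a ∷ v) v≢0 with a ≟ 0#
  ... | no a≢0 = 1# ∷ 0ᵛ , λ eq → a≢0 (begin
    a                     ≡⟨ sym (*-identityʳ a) ⟩
    a * 1#                ≡⟨ sym (+-identityʳ _) ⟩
    a * 1# + 0#           ≡⟨ cong (a * 1# +_) (sym (dot-zeroʳ v)) ⟩
    a * 1# + dot v 0ᵛ     ≡⟨ eq ⟩
    0#                    ∎)
  ... | yes refl with dot-nondegenerate _≟_ v (v≢0 ∘ cong (0# ∷_))
  ...   | u , vu≢0 = 0# ∷ u , λ eq → vu≢0 (trans (sym (trans (cong (_+ dot v u) (zeroˡ 0#)) (+-identityˡ _))) eq)

-- Subspaces of 𝔽_q^n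

module Subspaces (𝔽 : FiniteField) (n r : ℕ) where
  open ℕ-Sum using (∑; ∑-cong; ∑-map; ∑-↭; ∑-comm)
  open Counting using (count; count-pos; count-≡0; count-≡1; ∑-const)
  open FiniteField 𝔽 using (Carrier; isCommutativeRing; _≟_; _⁻¹; inverse; 0≢1; elements; complete; unique; q)
  open Poly 𝔽 n r hiding (_+ᵛ_; _·ᵛ_; 0ᵛ; dot)
  open VectorAlgebra isCommutativeRing
    using (commutativeRing; _+ᵛ_; _·ᵛ_; 0ᵛ; dot; +ᵛ-identityˡ; +ᵛ-identityʳ; +ᵛ-interchange; ·ᵛ-assoc; ·ᵛ-identityˡ; ·ᵛ-zeroˡ; ·ᵛ-zeroʳ;
           ·ᵛ-distribˡ; ·ᵛ-distribʳ; +ᵛ-·ᵛ-inverseʳ; +ᵛ-·ᵛ-inverseˡ; ·ᵛ-line-difference;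
           dot-+ᵛˡ; dot-·ᵛˡ; dot-lineˡ; dot-lineʳ; dot-zeroˡ; dot-zeroʳ; dot-comm; dot-nondegenerate)
  open CommutativeRing commutativeRing
    using (_+_; _*_; -_; 0#; 1#; *-comm; *-assoc; *-identityʳ; zeroˡ; zeroʳ; +-identityˡ; +-identityʳ; -‿inverseʳ)
  open import Algebra.Properties.Ring (CommutativeRing.ring commutativeRing) using (x∙y⁻¹≈ε⇒x≈y; -‿distribˡ-*)
  open ≡-Reasoning

  x*y≡0⇒x≡0 : ∀ {x y} → y ≢ 0# → x * y ≡ 0# → x ≡ 0#
  x*y≡0⇒x≡0 {x} {y} y≢0 xy≡0 = begin
    x                ≡⟨ sym (*-identityʳ x) ⟩
    x * 1#           ≡⟨ cong (x *_) (sym (inverse y y≢0)) ⟩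
    x * (y * y ⁻¹)   ≡⟨ sym (*-assoc x y (y ⁻¹)) ⟩
    x * y * y ⁻¹     ≡⟨ cong (_* y ⁻¹) xy≡0 ⟩
    0# * y ⁻¹        ≡⟨ zeroˡ (y ⁻¹) ⟩
    0#               ∎

  x+-[x*y⁻¹]*y≡0 : ∀ {y} → y ≢ 0# → ∀ x → x + - (x * y ⁻¹) * y ≡ 0#
  x+-[x*y⁻¹]*y≡0 {y} y≢0 x = begin
    x + - (x * y ⁻¹) * y     ≡⟨ cong (x +_) (sym (-‿distribˡ-* (x * y ⁻¹) y)) ⟩
    x + - (x * y ⁻¹ * y)     ≡⟨ cong (λ t → x + - t) (*-assoc x (y ⁻¹) y) ⟩
    x + - (x * (y ⁻¹ * y))   ≡⟨ cong (λ t → x + - (x * t)) (trans (*-comm (y ⁻¹) y) (inverse y y≢0)) ⟩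
    x + - (x * 1#)           ≡⟨ cong (λ t → x + - t) (*-identityʳ x) ⟩
    x + - x                  ≡⟨ -‿inverseʳ x ⟩
    0#                       ∎

  1<q : 1 < q
  1<q = distinct-members⇒2≤length (complete 0#) (complete 1#) 0≢1

  vecs-enumeration : ∀ m → IsEnumeration (vecs m)
  vecs-enumeration zero    = ([] ∷ []) , λ { [] → here refl }
  vecs-enumeration (suc m) = consAll-enumeration (unique , complete) (vecs-enumeration m)

  length-vecs : ∀ m → length (vecs m) ≡ q ℕ.^ m
  length-vecs zero    = refl
  length-vecs (suc m) = trans (length-consAll elements (vecs m)) (cong (q ℕ.*_) (length-vecs m))

  boolVecs-enumeration : ∀ m → IsEnumeration (boolVecs m)
  boolVecs-enumeration zero    = ([] ∷ []) , λ { [] → here refl }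
  boolVecs-enumeration (suc m) = consAll-enumeration bools (boolVecs-enumeration m)
    where
    bools : IsEnumeration (true ∷ false ∷ [])
    bools = (((λ ()) ∷ []) ∷ [] ∷ []) , λ { true → here refl ; false → there (here refl) }

  allE-unique : Unique allE
  allE-unique = proj₁ (vecs-enumeration n)

  ∈-allE : ∀ v → v ∈ allE
  ∈-allE = proj₂ (vecs-enumeration n)

  N≡q^n : N ≡ q ℕ.^ n
  N≡q^n = length-vecs n

  infix 4 _∈ˢ_ _∉ˢ_ _⊆ˢ_

  -- A record rather than `T (v ∈ₛ S)`, so that `S` can be inferred from a membership proof.
  record _∈ˢ_ (v : Vec Carrier n) (S : SubE) : Set where
    constructor mem
    field unmem : T (v ∈ₛ S)
  open _∈ˢ_

  _∉ˢ_ : Vec Carrier n → SubE → Set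
  v ∉ˢ S = ¬ v ∈ˢ S

  _⊆ˢ_ : SubE → SubE → Set
  A ⊆ˢ B = ∀ {v} → v ∈ˢ A → v ∈ˢ B

  _∈ˢ?_ : ∀ v S → Dec (v ∈ˢ S)
  v ∈ˢ? S = map′ mem unmem (T? (v ∈ₛ S))

  memAt-map : ∀ (p : Vec Carrier n → Bool) L {v} → v ∈ L → memAt (Vec.map p (Vec.fromList L)) (Vec.fromList L) v ≡ p v
  memAt-map p (u ∷ L) {v} v∈ with u ≟ᵛ v | v∈
  ... | yes refl | _          = refl
  ... | no u≢v   | here refl  = contradiction refl u≢v
  ... | no _     | there v∈L  = memAt-map p L v∈L

  map-memAt : ∀ L → Unique L → (S : Vec Bool (length L)) → Vec.map (memAt S (Vec.fromList L)) (Vec.fromList L) ≡ S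
  map-memAt []      []           []       = refl
  map-memAt (u ∷ L) (u∉L ∷ uL) (b ∷ bs) = cong₂ _∷_ head (trans (map-fromList-cong L skip-u) (map-memAt L uL bs))
    where
    head : memAt (b ∷ bs) (Vec.fromList (u ∷ L)) u ≡ b
    head with u ≟ᵛ u
    ... | yes _  = refl
    ... | no u≢u = contradiction refl u≢u
    skip-u : ∀ {v} → v ∈ L → memAt (b ∷ bs) (Vec.fromList (u ∷ L)) v ≡ memAt bs (Vec.fromList L) v
    skip-u {v} v∈L with u ≟ᵛ v
    ... | yes refl = contradiction refl (All.lookup u∉L v∈L)
    ... | no _     = refl

  ∈ₛ-fromPred : ∀ p v → v ∈ₛ fromPred p ≡ p v
  ∈ₛ-fromPred p v = memAt-map p allE (∈-allE v)

  fromPred⁺ : ∀ {p v} → T (p v) → v ∈ˢ fromPred p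
  fromPred⁺ {p} {v} = mem ∘ subst T (sym (∈ₛ-fromPred p v))

  fromPred⁻ : ∀ {p v} → v ∈ˢ fromPred p → T (p v)
  fromPred⁻ {p} {v} = subst T (∈ₛ-fromPred p v) ∘ unmem

  fromPred-∈ₛ : ∀ S → fromPred (_∈ₛ S) ≡ S
  fromPred-∈ₛ = map-memAt allE allE-unique

  ⊆ˢ-antisym : ∀ {A B} → A ⊆ˢ B → B ⊆ˢ A → A ≡ B
  ⊆ˢ-antisym {A} {B} A⊆B B⊆A = begin
    A                 ≡⟨ sym (fromPred-∈ₛ A) ⟩
    fromPred (_∈ₛ A)  ≡⟨ Vecₚ.map-cong (λ v → T-injective (unmem ∘ A⊆B ∘ mem) (unmem ∘ B⊆A ∘ mem)) allEᵛ ⟩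
    fromPred (_∈ₛ B)  ≡⟨ fromPred-∈ₛ B ⟩
    B                 ∎

  ⊆ˢ⇒⊆ₛ : ∀ {A B} → A ⊆ˢ B → A ⊆ₛ B
  ⊆ˢ⇒⊆ₛ A⊆B v v∈A = to T-≡ (unmem (A⊆B (mem (from T-≡ v∈A))))

  card-map : ∀ (p : Vec Carrier n → Bool) L → card (Vec.map p (Vec.fromList L)) ≡ count p L
  card-map p []      = refl
  card-map p (u ∷ L) with p u
  ... | true  = cong suc (card-map p L)
  ... | false = card-map p L

  card≡count : ∀ S → card S ≡ count (_∈ₛ S) allE
  card≡count S = trans (cong card (sym (fromPred-∈ₛ S))) (card-map (_∈ₛ S) allE)

  card≤length : ∀ {m} (S : Vec Bool m) → card S ≤ m
  card≤length []          = ℕ.z≤n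
  card≤length (true ∷ S)  = ℕ.s≤s (card≤length S)
  card≤length (false ∷ S) = ℕₚ.m≤n⇒m≤1+n (card≤length S)

  card-replicate : ∀ m → card (Vec.replicate m true) ≡ m
  card-replicate zero    = refl
  card-replicate (suc m) = cong suc (card-replicate m)

  record IsSubspace (S : SubE) : Set where
    field
      0ᵛ∈       : 0ᵛ ∈ˢ S
      +ᵛ-closed : ∀ {u v} → u ∈ˢ S → v ∈ˢ S → u +ᵛ v ∈ˢ S
      ·ᵛ-closed : ∀ a {v} → v ∈ˢ S → a ·ᵛ v ∈ˢ S

  isSubspace⇔IsSubspace : ∀ S → T (isSubspace S) ⇔ IsSubspace S
  isSubspace⇔IsSubspace S = mk⇔ decode encode
    where
    decode : T (isSubspace S) → IsSubspace S
    decode t = let 0∈ , closed = to T-∧ t ; +closed , ·closed = to T-∧ closed in record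
      { 0ᵛ∈       = mem 0∈
      ; +ᵛ-closed = λ {u} {v} (mem u∈) (mem v∈) →
          mem (to T-⇒ (to T-⇒ (to (T-all ∈-allE _) (to (T-all ∈-allE _) +closed u) v) u∈) v∈)
      ; ·ᵛ-closed = λ a {v} (mem v∈) → mem (to T-⇒ (to (T-all ∈-allE _) (to (T-all complete _) ·closed a) v) v∈)
      }
    encode : IsSubspace S → T (isSubspace S)
    encode S-sub = from T-∧ (unmem 0ᵛ∈ , from T-∧
      ( from (T-all ∈-allE _) (λ u → from (T-all ∈-allE _) λ v → from T-⇒ λ u∈ → from T-⇒ λ v∈ →
          unmem (+ᵛ-closed (mem u∈) (mem v∈)))
      , from (T-all complete _) (λ a → from (T-all ∈-allE _) λ v → from T-⇒ (unmem ∘ ·ᵛ-closed a ∘ mem))))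
      where open IsSubspace S-sub

  isSubspace≡true : ∀ {S} → IsSubspace S → isSubspace S ≡ true
  isSubspace≡true {S} = to T-≡ ∘ from (isSubspace⇔IsSubspace S)

  ΣE⁻ : ∀ {D} → D ∈ ΣE → IsSubspace D
  ΣE⁻ {D} D∈ = to (isSubspace⇔IsSubspace D) (proj₂ (∈-filter⁻ (T? ∘ isSubspace) {xs = boolVecs N} D∈))

  ΣE⁺ : ∀ {D} → IsSubspace D → D ∈ ΣE
  ΣE⁺ {D} D-sub = ∈-filter⁺ (T? ∘ isSubspace) (proj₂ (boolVecs-enumeration N) D)
                            (from (isSubspace⇔IsSubspace D) D-sub)

  ΣE-unique : Unique ΣE
  ΣE-unique = Unique.filter⁺ (T? ∘ isSubspace) (proj₁ (boolVecs-enumeration N))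

  0ˢ : SubE
  0ˢ = fromPred (λ v → ⌊ v ≟ᵛ 0ᵛ ⌋)

  0ˢ⁺ : 0ᵛ ∈ˢ 0ˢ
  0ˢ⁺ = fromPred⁺ (fromWitness refl)

  0ˢ⁻ : ∀ {v} → v ∈ˢ 0ˢ → v ≡ 0ᵛ
  0ˢ⁻ = toWitness ∘ fromPred⁻

  Eₛ⁺ : ∀ {v} → v ∈ˢ Eₛ
  Eₛ⁺ {v} = subst (v ∈ˢ_) (Vecₚ.map-const allEᵛ true) (fromPred⁺ _)

  span : Vec Carrier n → SubE
  span v = fromPred (λ w → any (λ a → ⌊ (a ·ᵛ v) ≟ᵛ w ⌋) elements)

  span⁺ : ∀ {v} a → a ·ᵛ v ∈ˢ span v
  span⁺ a = fromPred⁺ (from (T-any complete _) (a , fromWitness refl))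

  span⁻ : ∀ v {w} → w ∈ˢ span v → ∃[ a ] a ·ᵛ v ≡ w
  span⁻ v w∈ = let a , eq = to (T-any complete _) (fromPred⁻ w∈) in a , toWitness eq

  v∈span : ∀ v → v ∈ˢ span v
  v∈span v = subst (_∈ˢ span v) (·ᵛ-identityˡ v) (span⁺ 1#)

  +ₛ⁺ : ∀ {A B a b} → a ∈ˢ A → b ∈ˢ B → a +ᵛ b ∈ˢ A +ₛ B
  +ₛ⁺ {a = a} {b} a∈ b∈ =
    fromPred⁺ (from (T-any ∈-allE _) (a , from (T-any ∈-allE _) (b , from T-∧ (unmem a∈ , from T-∧ (unmem b∈ , fromWitness refl)))))

  +ₛ⁻ : ∀ A B {w} → w ∈ˢ A +ₛ B → ∃[ a ] ∃[ b ] a ∈ˢ A × b ∈ˢ B × a +ᵛ b ≡ w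
  +ₛ⁻ A B w∈ with a , t ← to (T-any ∈-allE _) (fromPred⁻ w∈) with b , t′ ← to (T-any ∈-allE _) t =
    let a∈ , t″ = to T-∧ t′ ; b∈ , eq = to T-∧ t″ in a , b , mem a∈ , mem b∈ , toWitness eq

  ⊥⁺ : ∀ J {v} → (∀ {u} → u ∈ˢ J → dot v u ≡ 0#) → v ∈ˢ J ⊥
  ⊥⁺ J orth = fromPred⁺ (from (T-all ∈-allE _) λ u → from T-⇒ (fromWitness ∘ orth ∘ mem))

  ⊥⁻ : ∀ {J v u} → v ∈ˢ J ⊥ → u ∈ˢ J → dot v u ≡ 0#
  ⊥⁻ {u = u} v∈ (mem u∈) = toWitness (to T-⇒ (to (T-all ∈-allE _) (fromPred⁻ v∈) u) u∈)

  ∉⊥ : ∀ {J v} → v ∉ˢ J ⊥ → ∃[ u ] u ∈ˢ J × dot v u ≢ 0#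
  ∉⊥ {J} v∉ with u , ¬t ← ¬T-all ∈-allE _ (v∉ ∘ fromPred⁺) with u ∈ₛ J in u∈
  ... | true  = u , mem (subst T (sym u∈) _) , ¬t ∘ fromWitness
  ... | false = contradiction _ ¬t

  0ˢ-subspace : IsSubspace 0ˢ
  0ˢ-subspace = record
    { 0ᵛ∈       = 0ˢ⁺
    ; +ᵛ-closed = λ u∈ v∈ → subst (_∈ˢ 0ˢ) (sym (trans (cong₂ _+ᵛ_ (0ˢ⁻ u∈) (0ˢ⁻ v∈)) (+ᵛ-identityʳ 0ᵛ))) 0ˢ⁺
    ; ·ᵛ-closed = λ a v∈ → subst (_∈ˢ 0ˢ) (sym (trans (cong (a ·ᵛ_) (0ˢ⁻ v∈)) (·ᵛ-zeroʳ a))) 0ˢ⁺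
    }

  Eₛ-subspace : IsSubspace Eₛ
  Eₛ-subspace = record { 0ᵛ∈ = Eₛ⁺ ; +ᵛ-closed = λ _ _ → Eₛ⁺ ; ·ᵛ-closed = λ _ _ → Eₛ⁺ }

  span-subspace : ∀ v → IsSubspace (span v)
  span-subspace v = record
    { 0ᵛ∈       = subst (_∈ˢ span v) (·ᵛ-zeroˡ v) (span⁺ 0#)
    ; +ᵛ-closed = λ u∈ w∈ → add (span⁻ v u∈) (span⁻ v w∈)
    ; ·ᵛ-closed = λ c w∈ → scale c (span⁻ v w∈)
    }
    where
    add : ∀ {u w} → ∃[ a ] a ·ᵛ v ≡ u → ∃[ b ] b ·ᵛ v ≡ w → u +ᵛ w ∈ˢ span v
    add (a , refl) (b , refl) = subst (_∈ˢ span v) (sym (·ᵛ-distribʳ a b v)) (span⁺ (a + b))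
    scale : ∀ c {w} → ∃[ a ] a ·ᵛ v ≡ w → c ·ᵛ w ∈ˢ span v
    scale c (a , refl) = subst (_∈ˢ span v) (sym (·ᵛ-assoc c a v)) (span⁺ (c * a))

  +ₛ-subspace : ∀ {A B} → IsSubspace A → IsSubspace B → IsSubspace (A +ₛ B)
  +ₛ-subspace {A} {B} A-sub B-sub = record
    { 0ᵛ∈       = subst (_∈ˢ A +ₛ B) (+ᵛ-identityʳ 0ᵛ) (+ₛ⁺ (0ᵛ∈ A-sub) (0ᵛ∈ B-sub))
    ; +ᵛ-closed = λ u∈ w∈ → add (+ₛ⁻ A B u∈) (+ₛ⁻ A B w∈)
    ; ·ᵛ-closed = λ c w∈ → scale c (+ₛ⁻ A B w∈)
    }
    where
    open IsSubspace
    add : ∀ {u w} → ∃[ a ] ∃[ b ] a ∈ˢ A × b ∈ˢ B × a +ᵛ b ≡ u → ∃[ a ] ∃[ b ] a ∈ˢ A × b ∈ˢ B × a +ᵛ b ≡ w →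
          u +ᵛ w ∈ˢ A +ₛ B
    add (a , b , a∈ , b∈ , refl) (a′ , b′ , a′∈ , b′∈ , refl) =
      subst (_∈ˢ A +ₛ B) (sym (+ᵛ-interchange a b a′ b′)) (+ₛ⁺ (+ᵛ-closed A-sub a∈ a′∈) (+ᵛ-closed B-sub b∈ b′∈))
    scale : ∀ c {w} → ∃[ a ] ∃[ b ] a ∈ˢ A × b ∈ˢ B × a +ᵛ b ≡ w → c ·ᵛ w ∈ˢ A +ₛ B
    scale c (a , b , a∈ , b∈ , refl) =
      subst (_∈ˢ A +ₛ B) (sym (·ᵛ-distribˡ c a b)) (+ₛ⁺ (·ᵛ-closed A-sub c a∈) (·ᵛ-closed B-sub c b∈))

  ⊥-subspace : ∀ J → IsSubspace (J ⊥)
  ⊥-subspace J = record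
    { 0ᵛ∈       = ⊥⁺ J λ {u} _ → dot-zeroˡ u
    ; +ᵛ-closed = λ {x} {y} x∈ y∈ → ⊥⁺ J λ {u} u∈ → begin
        dot (x +ᵛ y) u      ≡⟨ dot-+ᵛˡ x y u ⟩
        dot x u + dot y u   ≡⟨ cong₂ _+_ (⊥⁻ x∈ u∈) (⊥⁻ y∈ u∈) ⟩
        0# + 0#             ≡⟨ +-identityʳ 0# ⟩
        0#                  ∎
    ; ·ᵛ-closed = λ a {x} x∈ → ⊥⁺ J λ {u} u∈ → begin
        dot (a ·ᵛ x) u      ≡⟨ dot-·ᵛˡ a x u ⟩
        a * dot x u         ≡⟨ cong (a *_) (⊥⁻ x∈ u∈) ⟩
        a * 0#              ≡⟨ zeroʳ a ⟩
        0#                  ∎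
    }

  ⊆-+ₛˡ : ∀ {A B} → IsSubspace B → A ⊆ˢ A +ₛ B
  ⊆-+ₛˡ {A} {B} B-sub {a} a∈ = subst (_∈ˢ A +ₛ B) (+ᵛ-identityʳ a) (+ₛ⁺ a∈ (IsSubspace.0ᵛ∈ B-sub))

  ⊆-+ₛʳ : ∀ {A B} → IsSubspace A → B ⊆ˢ A +ₛ B
  ⊆-+ₛʳ {A} {B} A-sub {b} b∈ = subst (_∈ˢ A +ₛ B) (+ᵛ-identityˡ b) (+ₛ⁺ (IsSubspace.0ᵛ∈ A-sub) b∈)

  +span-⊆ : ∀ {A B v} → IsSubspace B → A ⊆ˢ B → v ∈ˢ B → A +ₛ span v ⊆ˢ B
  +span-⊆ {A} {B} {v} B-sub A⊆B v∈B u∈ with a , _ , a∈ , w∈ , refl ← +ₛ⁻ A (span v) u∈ with c , refl ← span⁻ v w∈ =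
    +ᵛ-closed (A⊆B a∈) (·ᵛ-closed c v∈B)
    where open IsSubspace B-sub

  count-translate : ∀ (p : Vec Carrier n → Bool) z c → count (λ x → p (x +ᵛ c ·ᵛ z)) allE ≡ count p allE
  count-translate p z c = begin
    count (p ∘ shift) allE             ≡⟨ ∑-map (indicator ∘ p) shift allE ⟨
    ∑ (indicator ∘ p) (map shift allE) ≡⟨ ∑-↭ (indicator ∘ p) shift-permutes ⟩
    count p allE                       ∎
    where
    shift : Vec Carrier n → Vec Carrier n
    shift x = x +ᵛ c ·ᵛ z
    shift-injective : ∀ {x y} → shift x ≡ shift y → x ≡ y
    shift-injective {x} {y} eq = begin
      x                           ≡⟨ sym (+ᵛ-·ᵛ-inverseʳ x z c) ⟩
      shift x +ᵛ (- c) ·ᵛ z       ≡⟨ cong (_+ᵛ (- c) ·ᵛ z) eq ⟩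
      shift y +ᵛ (- c) ·ᵛ z       ≡⟨ +ᵛ-·ᵛ-inverseʳ y z c ⟩
      y                           ∎
    shift-permutes : map shift allE ↭ allE
    shift-permutes = unique∧same-members⇒↭ (Unique.map⁺ shift-injective allE-unique) allE-unique
      (λ _ → ∈-allE _)
      (λ {y} _ → subst (_∈ map shift allE) (+ᵛ-·ᵛ-inverseˡ y z c) (∈-map⁺ shift (∈-allE (y +ᵛ (- c) ·ᵛ z))))

  card-fibres : ∀ S S₀ z →
                (∀ {x} → x ∈ˢ S → ∃[ c ] x +ᵛ c ·ᵛ z ∈ˢ S₀) →
                (∀ {x c} → x +ᵛ c ·ᵛ z ∈ˢ S₀ → x ∈ˢ S) →
                (∀ {x c c′} → x +ᵛ c ·ᵛ z ∈ˢ S₀ → x +ᵛ c′ ·ᵛ z ∈ˢ S₀ → c ≡ c′) →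
                card S ≡ q ℕ.* card S₀
  -- Double counting of the pairs (x , c) with x + c·z ∈ S₀.
  card-fibres S S₀ z meets lies-in meets-once = begin
    card S                                                    ≡⟨ card≡count S ⟩
    ∑ (λ x → indicator (x ∈ₛ S)) allE                         ≡⟨ ∑-cong allE (λ {x} _ → sym (fibre x)) ⟩
    ∑ (λ x → ∑ (λ c → indicator (on-line x c)) elements) allE ≡⟨ ∑-comm (λ x c → indicator (on-line x c)) allE elements ⟩
    ∑ (λ c → count (λ x → on-line x c) allE) elements         ≡⟨ ∑-cong elements (λ {c} _ → count-translate (_∈ₛ S₀) z c) ⟩
    ∑ (λ _ → count (_∈ₛ S₀) allE) elements                    ≡⟨ ∑-const (count (_∈ₛ S₀) allE) elements ⟩
    q ℕ.* count (_∈ₛ S₀) allE                                 ≡⟨ cong (q ℕ.*_) (card≡count S₀) ⟨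
    q ℕ.* card S₀                                             ∎
    where
    on-line : Vec Carrier n → Carrier → Bool
    on-line x c = (x +ᵛ c ·ᵛ z) ∈ₛ S₀
    fibre : ∀ x → count (on-line x) elements ≡ indicator (x ∈ₛ S)
    fibre x with x ∈ₛ S in x∈S
    ... | true  = let c , on = meets (mem (subst T (sym x∈S) _)) in
                  count-≡1 (on-line x) elements unique (complete c) (unmem on) (λ _ t → meets-once (mem t) on)
    ... | false = count-≡0 (on-line x) elements (λ _ t → subst T x∈S (unmem (lies-in (mem t))))

  card-pos : ∀ {A} → IsSubspace A → 1 ≤ card A
  card-pos {A} A-sub = subst (1 ≤_) (sym (card≡count A)) (count-pos (_∈ₛ A) allE (∈-allE 0ᵛ) (unmem (IsSubspace.0ᵛ∈ A-sub)))

  card-0ˢ : card 0ˢ ≡ 1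
  card-0ˢ = trans (card≡count 0ˢ)
                  (count-≡1 (_∈ₛ 0ˢ) allE allE-unique (∈-allE 0ᵛ) (unmem 0ˢ⁺) (λ _ t → 0ˢ⁻ (mem t)))

  ·ᵛ∈⇒≡0 : ∀ {A v} → IsSubspace A → v ∉ˢ A → ∀ {d} → d ·ᵛ v ∈ˢ A → d ≡ 0#
  ·ᵛ∈⇒≡0 {A} {v} A-sub v∉A {d} dv∈A with d ≟ 0#
  ... | yes d≡0 = d≡0
  ... | no  d≢0 = contradiction (subst (_∈ˢ A) d⁻¹dv≡v (IsSubspace.·ᵛ-closed A-sub (d ⁻¹) dv∈A)) v∉A
    where
    d⁻¹dv≡v : d ⁻¹ ·ᵛ d ·ᵛ v ≡ v
    d⁻¹dv≡v = begin
      d ⁻¹ ·ᵛ d ·ᵛ v     ≡⟨ ·ᵛ-assoc (d ⁻¹) d v ⟩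
      (d ⁻¹ * d) ·ᵛ v    ≡⟨ cong (_·ᵛ v) (trans (*-comm (d ⁻¹) d) (inverse d d≢0)) ⟩
      1# ·ᵛ v            ≡⟨ ·ᵛ-identityˡ v ⟩
      v                  ∎

  line-meets-once : ∀ {S z} → IsSubspace S → (∀ {d} → d ·ᵛ z ∈ˢ S → d ≡ 0#) →
                    ∀ {x c c′} → x +ᵛ c ·ᵛ z ∈ˢ S → x +ᵛ c′ ·ᵛ z ∈ˢ S → c ≡ c′
  line-meets-once {S} {z} S-sub free {x} {c} {c′} on on′ = x∙y⁻¹≈ε⇒x≈y c c′ (free difference∈S)
    where
    open IsSubspace S-sub
    difference∈S : (c + - c′) ·ᵛ z ∈ˢ S
    difference∈S = subst (_∈ˢ S) (·ᵛ-line-difference x z c c′) (+ᵛ-closed on (·ᵛ-closed (- 1#) on′))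

  card-+span : ∀ {A v} → IsSubspace A → v ∉ˢ A → card (A +ₛ span v) ≡ q ℕ.* card A
  card-+span {A} {v} A-sub v∉A =
    card-fibres (A +ₛ span v) A v meets lies-in (line-meets-once A-sub (·ᵛ∈⇒≡0 A-sub v∉A))
    where
    meets : ∀ {x} → x ∈ˢ A +ₛ span v → ∃[ c ] x +ᵛ c ·ᵛ v ∈ˢ A
    meets x∈ with a , _ , a∈ , w∈ , refl ← +ₛ⁻ A (span v) x∈ with c , refl ← span⁻ v w∈ =
      - c , subst (_∈ˢ A) (sym (+ᵛ-·ᵛ-inverseʳ a v c)) a∈
    lies-in : ∀ {x c} → x +ᵛ c ·ᵛ v ∈ˢ A → x ∈ˢ A +ₛ span v
    lies-in {x} {c} on = subst (_∈ˢ A +ₛ span v) (+ᵛ-·ᵛ-inverseʳ x v c) (+ₛ⁺ on (span⁺ (- c)))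

  card-+span-grows : ∀ {A v} → IsSubspace A → v ∉ˢ A → card A < card (A +ₛ span v)
  card-+span-grows {A} A-sub v∉A =
    subst (card A <_) (trans (ℕₚ.*-comm (card A) q) (sym (card-+span A-sub v∉A)))
          (ℕₚ.m<m*n (card A) q ⦃ ℕ.>-nonZero (card-pos A-sub) ⦄ 1<q)

  subspace-induction : ∀ (P : SubE → Set) → (∀ {A v} → IsSubspace A → v ∉ˢ A → P A → P (A +ₛ span v)) →
                       ∀ {A B} → IsSubspace A → IsSubspace B → A ⊆ˢ B → P A → P B
  -- Adding a vector outside A strictly decreases N ∸ card A, which `fuel` bounds.
  subspace-induction P step {A} {B} A-sub B-sub = grow (N ∸ card A) ℕₚ.≤-refl A-sub
    where
    grow : ∀ fuel {A} → N ∸ card A ≤ fuel → IsSubspace A → A ⊆ˢ B → P A → P B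
    grow fuel {A} bound A-sub A⊆B PA with any? (λ v → (v ∈ˢ? B) ×-dec ¬? (v ∈ˢ? A)) allE
    ... | no none = subst P (⊆ˢ-antisym A⊆B B⊆A) PA
      where
      B⊆A : B ⊆ˢ A
      B⊆A {v} v∈B = decidable-stable (v ∈ˢ? A) λ v∉A → none (lose (∈-allE v) (v∈B , v∉A))
    ... | yes found with v , _ , v∈B , v∉A ← find found
        with fuel | ℕₚ.<-≤-trans (ℕₚ.∸-monoʳ-< (card-+span-grows A-sub v∉A) (card≤length (A +ₛ span v))) bound
    ...   | suc fuel′ | ℕ.s≤s bound′ =
            grow fuel′ bound′ (+ₛ-subspace A-sub (span-subspace v)) (+span-⊆ B-sub A⊆B v∈B) (step A-sub v∉A PA)

  -- Orthogonal complements

  ⊥-antitone : ∀ {A B} → A ⊆ˢ B → B ⊥ ⊆ˢ A ⊥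
  ⊥-antitone {A} A⊆B y∈ = ⊥⁺ A λ u∈ → ⊥⁻ y∈ (A⊆B u∈)

  ⊆⊥⊥ : ∀ {S} → S ⊆ˢ S ⊥ ⊥
  ⊆⊥⊥ {S} {u} u∈ = ⊥⁺ (S ⊥) λ {y} y∈ → trans (dot-comm u y) (⊥⁻ y∈ u∈)

  0ˢ⊥≡Eₛ : 0ˢ ⊥ ≡ Eₛ
  0ˢ⊥≡Eₛ = ⊆ˢ-antisym (λ _ → Eₛ⁺) λ {v} _ → ⊥⁺ 0ˢ λ u∈ → trans (cong (dot v) (0ˢ⁻ u∈)) (dot-zeroʳ v)

  Eₛ⊥≡0ˢ : Eₛ ⊥ ≡ 0ˢ
  Eₛ⊥≡0ˢ = ⊆ˢ-antisym ⊆0ˢ (λ {v} v∈ → ⊥⁺ Eₛ λ {u} _ → trans (cong (λ x → dot x u) (0ˢ⁻ v∈)) (dot-zeroˡ u))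
    where
    ⊆0ˢ : Eₛ ⊥ ⊆ˢ 0ˢ
    ⊆0ˢ {v} v∈ with v ≟ᵛ 0ᵛ
    ... | yes refl = 0ˢ⁺
    ... | no  v≢0  = let u , vu≢0 = dot-nondegenerate _≟_ v v≢0 in contradiction (⊥⁻ v∈ Eₛ⁺) vu≢0

  +span-⊥⁺ : ∀ {A v y} → y ∈ˢ A ⊥ → dot y v ≡ 0# → y ∈ˢ (A +ₛ span v) ⊥
  +span-⊥⁺ {A} {v} {y} y∈ yv≡0 = ⊥⁺ (A +ₛ span v) orthogonal
    where
    orthogonal : ∀ {u} → u ∈ˢ A +ₛ span v → dot y u ≡ 0#
    orthogonal u∈ with a , _ , a∈ , w∈ , refl ← +ₛ⁻ A (span v) u∈ with c , refl ← span⁻ v w∈ = begin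
      dot y (a +ᵛ c ·ᵛ v)       ≡⟨ dot-lineʳ y a v c ⟩
      dot y a + c * dot y v     ≡⟨ cong₂ (λ s t → s + c * t) (⊥⁻ y∈ a∈) yv≡0 ⟩
      0# + c * 0#               ≡⟨ trans (+-identityˡ _) (zeroʳ c) ⟩
      0#                        ∎

  +span-⊥⁻ : ∀ {A v y} → IsSubspace A → y ∈ˢ (A +ₛ span v) ⊥ → y ∈ˢ A ⊥ × dot y v ≡ 0#
  +span-⊥⁻ {A} {v} A-sub y∈ = ⊥-antitone (⊆-+ₛˡ {A} (span-subspace v)) y∈ , ⊥⁻ y∈ (⊆-+ₛʳ A-sub (v∈span v))

  ⊥-project : ∀ {A v w y} → IsSubspace A → w ∈ˢ A ⊥ → dot w v ≢ 0# → y ∈ˢ A ⊥ →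
              ∃[ c ] y +ᵛ c ·ᵛ w ∈ˢ (A +ₛ span v) ⊥
  ⊥-project {A} {v} {w} {y} A-sub w∈ wv≢0 y∈ = c , +span-⊥⁺ {A} {v} on-A⊥ on-v⊥
    where
    open IsSubspace (⊥-subspace A)
    c = - (dot y v * dot w v ⁻¹)
    on-A⊥ : y +ᵛ c ·ᵛ w ∈ˢ A ⊥
    on-A⊥ = +ᵛ-closed y∈ (·ᵛ-closed c w∈)
    on-v⊥ : dot (y +ᵛ c ·ᵛ w) v ≡ 0#
    on-v⊥ = trans (dot-lineˡ y w v c) (x+-[x*y⁻¹]*y≡0 wv≢0 (dot y v))

  card-⊥-+span : ∀ {A v w} → IsSubspace A → w ∈ˢ A ⊥ → dot w v ≢ 0# →
                 card (A ⊥) ≡ q ℕ.* card ((A +ₛ span v) ⊥)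
  card-⊥-+span {A} {v} {w} A-sub w∈ wv≢0 =
    card-fibres (A ⊥) ((A +ₛ span v) ⊥) w (⊥-project A-sub w∈ wv≢0) lies-in
                (line-meets-once (⊥-subspace (A +ₛ span v)) free)
    where
    open IsSubspace (⊥-subspace A)
    lies-in : ∀ {x c} → x +ᵛ c ·ᵛ w ∈ˢ (A +ₛ span v) ⊥ → x ∈ˢ A ⊥
    lies-in {x} {c} on = subst (_∈ˢ A ⊥) (+ᵛ-·ᵛ-inverseʳ x w c)
                               (+ᵛ-closed (proj₁ (+span-⊥⁻ A-sub on)) (·ᵛ-closed (- c) w∈))
    free : ∀ {d} → d ·ᵛ w ∈ˢ (A +ₛ span v) ⊥ → d ≡ 0#
    free {d} dw∈ = x*y≡0⇒x≡0 wv≢0 (trans (sym (dot-·ᵛˡ d w v)) (proj₂ (+span-⊥⁻ A-sub dw∈)))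

  ⊥⊥-+span : ∀ {A v w} → IsSubspace A → A ⊥ ⊥ ≡ A → w ∈ˢ A ⊥ → dot w v ≢ 0# →
             (A +ₛ span v) ⊥ ⊥ ≡ A +ₛ span v
  ⊥⊥-+span {A} {v} {w} A-sub A⊥⊥≡A w∈ wv≢0 = ⊆ˢ-antisym ⊥⊥⊆ ⊆⊥⊥
    where
    A′ = A +ₛ span v
    ⊥⊥⊆ : A′ ⊥ ⊥ ⊆ˢ A′
    -- b makes x + b·v orthogonal to w; since every y ∈ A⊥ differs from a vector of A′⊥ by a
    -- multiple of w, x + b·v is then orthogonal to A⊥, i.e. lies in A⊥⊥ = A.
    ⊥⊥⊆ {x} x∈ = subst (_∈ˢ A′) (+ᵛ-·ᵛ-inverseʳ x v b) (+ₛ⁺ x′∈A (span⁺ (- b)))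
      where
      vw≢0 : dot v w ≢ 0#
      vw≢0 = wv≢0 ∘ trans (dot-comm w v)
      b = - (dot x w * dot v w ⁻¹)
      x′ = x +ᵛ b ·ᵛ v
      x′∈A′⊥⊥ : x′ ∈ˢ A′ ⊥ ⊥
      x′∈A′⊥⊥ = +ᵛ-closed x∈ (·ᵛ-closed b (⊆⊥⊥ (⊆-+ₛʳ A-sub (v∈span v))))
        where open IsSubspace (⊥-subspace (A′ ⊥))
      x′⊥w : dot x′ w ≡ 0#
      x′⊥w = trans (dot-lineˡ x v w b) (x+-[x*y⁻¹]*y≡0 vw≢0 (dot x w))
      x′⊥A⊥ : ∀ {y} → y ∈ˢ A ⊥ → dot x′ y ≡ 0#
      x′⊥A⊥ {y} y∈ with c , y′∈ ← ⊥-project A-sub w∈ wv≢0 y∈ = begin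
        dot x′ y                                      ≡⟨ cong (dot x′) (sym (+ᵛ-·ᵛ-inverseʳ y w c)) ⟩
        dot x′ (y +ᵛ c ·ᵛ w +ᵛ (- c) ·ᵛ w)            ≡⟨ dot-lineʳ x′ _ w (- c) ⟩
        dot x′ (y +ᵛ c ·ᵛ w) + - c * dot x′ w         ≡⟨ cong₂ (λ s t → s + - c * t) (⊥⁻ x′∈A′⊥⊥ y′∈) x′⊥w ⟩
        0# + - c * 0#                                 ≡⟨ trans (+-identityˡ _) (zeroʳ (- c)) ⟩
        0#                                            ∎
      x′∈A : x′ ∈ˢ A
      x′∈A = subst (x′ ∈ˢ_) A⊥⊥≡A (⊥⁺ (A ⊥) x′⊥A⊥)

  record ⊥-Invariants (A : SubE) : Set where
    field
      ⊥⊥≡        : A ⊥ ⊥ ≡ A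
      card*card⊥ : card A ℕ.* card (A ⊥) ≡ N
      exponent   : ℕ
      card≡q^    : card A ≡ q ℕ.^ exponent

  ⊥-invariants-0ˢ : ⊥-Invariants 0ˢ
  ⊥-invariants-0ˢ = record
    { ⊥⊥≡        = trans (cong _⊥ 0ˢ⊥≡Eₛ) Eₛ⊥≡0ˢ
    ; card*card⊥ = trans (cong₂ ℕ._*_ card-0ˢ (cong card 0ˢ⊥≡Eₛ)) (trans (ℕₚ.*-identityˡ _) (card-replicate N))
    ; exponent   = 0
    ; card≡q^    = card-0ˢ
    }

  ⊥-invariants-+span : ∀ {A v} → IsSubspace A → v ∉ˢ A → ⊥-Invariants A → ⊥-Invariants (A +ₛ span v)
  ⊥-invariants-+span {A} {v} A-sub v∉A inv = record
    { ⊥⊥≡        = ⊥⊥-+span A-sub ⊥⊥≡ w∈ wv≢0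
    ; card*card⊥ = begin
        card (A +ₛ span v) ℕ.* card ((A +ₛ span v) ⊥)   ≡⟨ cong (ℕ._* card ((A +ₛ span v) ⊥)) (card-+span A-sub v∉A) ⟩
        q ℕ.* card A ℕ.* card ((A +ₛ span v) ⊥)        ≡⟨ cong (ℕ._* card ((A +ₛ span v) ⊥)) (ℕₚ.*-comm q (card A)) ⟩
        card A ℕ.* q ℕ.* card ((A +ₛ span v) ⊥)        ≡⟨ ℕₚ.*-assoc (card A) q (card ((A +ₛ span v) ⊥)) ⟩
        card A ℕ.* (q ℕ.* card ((A +ₛ span v) ⊥))      ≡⟨ cong (card A ℕ.*_) (card-⊥-+span A-sub w∈ wv≢0) ⟨
        card A ℕ.* card (A ⊥)                           ≡⟨ card*card⊥ ⟩
        N                                               ∎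
    ; exponent   = suc exponent
    ; card≡q^    = trans (card-+span A-sub v∉A) (cong (q ℕ.*_) card≡q^)
    }
    where
    open ⊥-Invariants inv
    witness : ∃[ w ] w ∈ˢ A ⊥ × dot v w ≢ 0#
    witness = ∉⊥ (v∉A ∘ subst (v ∈ˢ_) ⊥⊥≡)
    w = proj₁ witness
    w∈ = proj₁ (proj₂ witness)
    wv≢0 : dot w v ≢ 0#
    wv≢0 = proj₂ (proj₂ witness) ∘ trans (dot-comm v w)

  ⊥-invariants : ∀ {D} → IsSubspace D → ⊥-Invariants D
  ⊥-invariants D-sub = subspace-induction ⊥-Invariants ⊥-invariants-+span 0ˢ-subspace D-sub 0ˢ⊆ ⊥-invariants-0ˢ
    where
    0ˢ⊆ : 0ˢ ⊆ˢ _
    0ˢ⊆ u∈ = subst (_∈ˢ _) (sym (0ˢ⁻ u∈)) (IsSubspace.0ᵛ∈ D-sub)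

  ⊥-involutive : ∀ {D} → IsSubspace D → D ⊥ ⊥ ≡ D
  ⊥-involutive = ⊥-Invariants.⊥⊥≡ ∘ ⊥-invariants

  ⊥-permutes-ΣE : map _⊥ ΣE ↭ ΣE
  ⊥-permutes-ΣE = unique∧same-members⇒↭ (Unique-map⁺ ⊥-injective ΣE-unique) ΣE-unique
    (λ J∈ → let D , _ , J≡D⊥ = ∈-map⁻ _⊥ J∈ in subst (_∈ ΣE) (sym J≡D⊥) (ΣE⁺ (⊥-subspace D)))
    (λ {D} D∈ → subst (_∈ map _⊥ ΣE) (⊥-involutive (ΣE⁻ D∈)) (∈-map⁺ _⊥ (ΣE⁺ (⊥-subspace D))))
    where
    ⊥-injective : ∀ {D D′} → D ∈ ΣE → D′ ∈ ΣE → D ⊥ ≡ D′ ⊥ → D ≡ D′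
    ⊥-injective D∈ D′∈ eq = trans (sym (⊥-involutive (ΣE⁻ D∈))) (trans (cong _⊥ eq) (⊥-involutive (ΣE⁻ D′∈)))

  logq-q^ : ∀ {k} j → k ≤ j → logq (q ℕ.^ k) j ≡ k
  logq-q^         zero    ℕ.z≤n = refl
  logq-q^ {k} (suc j) k≤1+j = step (q ℕ.^ suc j ℕ.≟ q ℕ.^ k)
    where
    step : (d : Dec (q ℕ.^ suc j ≡ q ℕ.^ k)) → (if ⌊ d ⌋ then suc j else logq (q ℕ.^ k) j) ≡ k
    step (yes eq) = ^-injectiveʳ 1<q eq
    step (no neq) = logq-q^ j (ℕₚ.≤-pred (ℕₚ.≤∧≢⇒< k≤1+j (neq ∘ cong (q ℕ.^_) ∘ sym)))

  card≡q^dim : ∀ {D} → IsSubspace D → card D ≡ q ℕ.^ dim D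
  card≡q^dim {D} D-sub = trans card≡q^ (cong (q ℕ.^_) (sym dim≡exponent))
    where
    open ⊥-Invariants (⊥-invariants D-sub)
    dim≡exponent : dim D ≡ exponent
    dim≡exponent = trans (cong (λ c → logq c n) card≡q^)
                         (logq-q^ n (^-cancelʳ-≤ 1<q (subst₂ _≤_ card≡q^ N≡q^n (card≤length D))))

  dim-+span : ∀ {A v} → IsSubspace A → v ∉ˢ A → dim (A +ₛ span v) ≡ suc (dim A)
  dim-+span {A} {v} A-sub v∉A = ^-injectiveʳ 1<q (begin
    q ℕ.^ dim (A +ₛ span v)   ≡⟨ card≡q^dim (+ₛ-subspace A-sub (span-subspace v)) ⟨
    card (A +ₛ span v)        ≡⟨ card-+span A-sub v∉A ⟩
    q ℕ.* card A              ≡⟨ cong (q ℕ.*_) (card≡q^dim A-sub) ⟩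
    q ℕ.^ suc (dim A)         ∎)

  dim+dim⊥ : ∀ {D} → IsSubspace D → dim D ℕ.+ dim (D ⊥) ≡ n
  dim+dim⊥ {D} D-sub = ^-injectiveʳ 1<q (begin
    q ℕ.^ (dim D ℕ.+ dim (D ⊥))         ≡⟨ ℕₚ.^-distribˡ-+-* q (dim D) (dim (D ⊥)) ⟩
    q ℕ.^ dim D ℕ.* q ℕ.^ dim (D ⊥)     ≡⟨ cong₂ ℕ._*_ (card≡q^dim D-sub) (card≡q^dim (⊥-subspace D)) ⟨
    card D ℕ.* card (D ⊥)               ≡⟨ ⊥-Invariants.card*card⊥ (⊥-invariants D-sub) ⟩
    N                                   ≡⟨ N≡q^n ⟩
    q ℕ.^ n                             ∎)

  dim-Eₛ : dim Eₛ ≡ n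
  dim-Eₛ = ^-injectiveʳ 1<q (trans (sym (card≡q^dim Eₛ-subspace)) (trans (card-replicate N) N≡q^n))

  dim-0ˢ : dim 0ˢ ≡ 0
  dim-0ˢ = ^-injectiveʳ 1<q (trans (sym (card≡q^dim 0ˢ-subspace)) card-0ˢ)

  dim-span : ∀ {v} → v ∉ˢ 0ˢ → dim (span v) ≡ 1
  dim-span {v} v∉0ˢ = trans (cong dim span≡0ˢ+span) (trans (dim-+span 0ˢ-subspace v∉0ˢ) (cong suc dim-0ˢ))
    where
    open IsSubspace (span-subspace v)
    span≡0ˢ+span : span v ≡ 0ˢ +ₛ span v
    span≡0ˢ+span = ⊆ˢ-antisym (⊆-+ₛʳ 0ˢ-subspace)
      (+span-⊆ (span-subspace v) (λ u∈ → subst (_∈ˢ span v) (sym (0ˢ⁻ u∈)) 0ᵛ∈) (v∈span v))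

-- Polymatroid duality

module PolymatroidDuality (𝔽 : FiniteField) (n r : ℕ) (P : Poly.Polymatroid 𝔽 n r) where
  open Poly 𝔽 n r using (SubE; Eₛ; _+ₛ_; _∩ₛ_; _⊥; dim; dualρ; f; Polymatroid)
  open Subspaces 𝔽 n r
  open Polymatroid P

  ρ-+span≤ : ∀ {A v} → IsSubspace A → v ∉ˢ A → ρ (A +ₛ span v) ≤ ρ A ℕ.+ r
  ρ-+span≤ {A} {v} A-sub v∉A = begin
    ρ (A +ₛ span v)                          ≤⟨ ℕₚ.m≤m+n _ (ρ (A ∩ₛ span v)) ⟩
    ρ (A +ₛ span v) ℕ.+ ρ (A ∩ₛ span v)      ≤⟨ R3 A (span v) (isSubspace≡true A-sub) (isSubspace≡true (span-subspace v)) ⟩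
    ρ A ℕ.+ ρ (span v)                       ≤⟨ ℕₚ.+-monoʳ-≤ (ρ A) ρ-span≤r ⟩
    ρ A ℕ.+ r                                ∎
    where
    open ℕₚ.≤-Reasoning
    v∉0ˢ : v ∉ˢ 0ˢ
    v∉0ˢ v∈0ˢ = v∉A (subst (_∈ˢ A) (sym (0ˢ⁻ v∈0ˢ)) (IsSubspace.0ᵛ∈ A-sub))
    ρ-span≤r : ρ (span v) ≤ r
    ρ-span≤r = subst (ρ (span v) ≤_) (trans (cong (r ℕ.*_) (dim-span v∉0ˢ)) (ℕₚ.*-identityʳ r))
                     (R1 (span v) (isSubspace≡true (span-subspace v)))

  ρ-growth : ∀ {A B} → IsSubspace A → IsSubspace B → A ⊆ˢ B → ρ B ℕ.+ r ℕ.* dim A ≤ ρ A ℕ.+ r ℕ.* dim B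
  ρ-growth {A} A-sub B-sub A⊆B = subspace-induction Bounded step A-sub B-sub A⊆B ℕₚ.≤-refl
    where
    open ℕₚ.≤-Reasoning
    open import Algebra.Properties.CommutativeSemigroup ℕₚ.+-commutativeSemigroup using (xy∙z≈xz∙y)
    Bounded : SubE → Set
    Bounded C = ρ C ℕ.+ r ℕ.* dim A ≤ ρ A ℕ.+ r ℕ.* dim C
    step : ∀ {C v} → IsSubspace C → v ∉ˢ C → Bounded C → Bounded (C +ₛ span v)
    step {C} {v} C-sub v∉C bounded = begin
      ρ (C +ₛ span v) ℕ.+ r ℕ.* dim A   ≤⟨ ℕₚ.+-monoˡ-≤ (r ℕ.* dim A) (ρ-+span≤ C-sub v∉C) ⟩
      ρ C ℕ.+ r ℕ.+ r ℕ.* dim A         ≡⟨ xy∙z≈xz∙y (ρ C) r (r ℕ.* dim A) ⟩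
      ρ C ℕ.+ r ℕ.* dim A ℕ.+ r         ≤⟨ ℕₚ.+-monoˡ-≤ r bounded ⟩
      ρ A ℕ.+ r ℕ.* dim C ℕ.+ r         ≡⟨ xy∙z≈xz∙y (ρ A) (r ℕ.* dim C) r ⟩
      ρ A ℕ.+ r ℕ.+ r ℕ.* dim C         ≡⟨ ℕₚ.+-assoc (ρ A) r (r ℕ.* dim C) ⟩
      ρ A ℕ.+ (r ℕ.+ r ℕ.* dim C)       ≡⟨ cong (ρ A ℕ.+_) (ℕₚ.*-suc r (dim C)) ⟨
      ρ A ℕ.+ r ℕ.* suc (dim C)         ≡⟨ cong (λ d → ρ A ℕ.+ r ℕ.* d) (dim-+span C-sub v∉C) ⟨
      ρ A ℕ.+ r ℕ.* dim (C +ₛ span v)   ∎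

  ρEₛ≤ρ⊥+r*dim : ∀ {D} → IsSubspace D → ρ Eₛ ≤ ρ (D ⊥) ℕ.+ r ℕ.* dim D
  ρEₛ≤ρ⊥+r*dim {D} D-sub = ℕₚ.+-cancelʳ-≤ (r ℕ.* dim (D ⊥)) (ρ Eₛ) (ρ (D ⊥) ℕ.+ r ℕ.* dim D) (begin
    ρ Eₛ ℕ.+ r ℕ.* dim (D ⊥)                      ≤⟨ ρ-growth (⊥-subspace D) Eₛ-subspace (λ _ → Eₛ⁺) ⟩
    ρ (D ⊥) ℕ.+ r ℕ.* dim Eₛ                      ≡⟨ cong (λ d → ρ (D ⊥) ℕ.+ r ℕ.* d) (trans dim-Eₛ (sym (dim+dim⊥ D-sub))) ⟩
    ρ (D ⊥) ℕ.+ r ℕ.* (dim D ℕ.+ dim (D ⊥))      ≡⟨ cong (ρ (D ⊥) ℕ.+_) (ℕₚ.*-distribˡ-+ r (dim D) (dim (D ⊥))) ⟩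
    ρ (D ⊥) ℕ.+ (r ℕ.* dim D ℕ.+ r ℕ.* dim (D ⊥)) ≡⟨ ℕₚ.+-assoc (ρ (D ⊥)) _ _ ⟨
    ρ (D ⊥) ℕ.+ r ℕ.* dim D ℕ.+ r ℕ.* dim (D ⊥)   ∎)
    where open ℕₚ.≤-Reasoning

  ρ-0ˢ : ρ 0ˢ ≡ 0
  ρ-0ˢ = ℕₚ.n≤0⇒n≡0 (subst (ρ 0ˢ ≤_) (trans (cong (r ℕ.*_) dim-0ˢ) (ℕₚ.*-zeroʳ r)) (R1 0ˢ (isSubspace≡true 0ˢ-subspace)))

  f-dual : ∀ {D} → IsSubspace D → ∀ X Y → f (dualρ ρ) D X Y ≡ f ρ (D ⊥) Y X
  f-dual {D} D-sub X Y = begin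
    X ℤ.^ (dualρ ρ Eₛ ∸ dualρ ρ D) ℤ.* Y ℤ.^ (a ∸ dualρ ρ D) ≡⟨ cong₂ (λ i j → X ℤ.^ i ℤ.* Y ℤ.^ j) exponentˣ exponentʸ ⟩
    X ℤ.^ (b ∸ s) ℤ.* Y ℤ.^ (e ∸ s)                          ≡⟨ ℤₚ.*-comm (X ℤ.^ (b ∸ s)) (Y ℤ.^ (e ∸ s)) ⟩
    Y ℤ.^ (e ∸ s) ℤ.* X ℤ.^ (b ∸ s)                          ∎
    where
    open ≡-Reasoning
    e = ρ Eₛ
    s = ρ (D ⊥)
    a = r ℕ.* dim D
    b = r ℕ.* dim (D ⊥)
    s≤e : s ≤ e
    s≤e = R2 (D ⊥) Eₛ (isSubspace≡true (⊥-subspace D)) (isSubspace≡true Eₛ-subspace) (⊆ˢ⇒⊆ₛ {D ⊥} (λ _ → Eₛ⁺))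
    e≤s+a : e ≤ s ℕ.+ a
    e≤s+a = ρEₛ≤ρ⊥+r*dim D-sub
    dualρEₛ≡ : dualρ ρ Eₛ ≡ (a ℕ.+ b) ∸ e
    dualρEₛ≡ = cong (_∸ e) (begin
      ρ (Eₛ ⊥) ℕ.+ r ℕ.* dim Eₛ              ≡⟨ cong₂ ℕ._+_ (trans (cong ρ Eₛ⊥≡0ˢ) ρ-0ˢ) (cong (r ℕ.*_) (trans dim-Eₛ (sym (dim+dim⊥ D-sub)))) ⟩
      r ℕ.* (dim D ℕ.+ dim (D ⊥))            ≡⟨ ℕₚ.*-distribˡ-+ r (dim D) (dim (D ⊥)) ⟩
      a ℕ.+ b                                ∎)
    exponentˣ : dualρ ρ Eₛ ∸ dualρ ρ D ≡ b ∸ s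
    exponentˣ = begin
      dualρ ρ Eₛ ∸ ((s ℕ.+ a) ∸ e)           ≡⟨ cong (_∸ ((s ℕ.+ a) ∸ e)) dualρEₛ≡ ⟩
      (a ℕ.+ b) ∸ e ∸ ((s ℕ.+ a) ∸ e)        ≡⟨ [m∸o]∸[n∸o]≡m∸n (a ℕ.+ b) e≤s+a ⟩
      (a ℕ.+ b) ∸ (s ℕ.+ a)                  ≡⟨ cong ((a ℕ.+ b) ∸_) (ℕₚ.+-comm s a) ⟩
      (a ℕ.+ b) ∸ (a ℕ.+ s)                  ≡⟨ ℕₚ.[m+n]∸[m+o]≡n∸o a b s ⟩
      b ∸ s                                  ∎
    exponentʸ : a ∸ dualρ ρ D ≡ e ∸ s
    exponentʸ = m∸[[n+m]∸o]≡o∸n s≤e e≤s+a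

theorem2p6 : (𝔽 : FiniteField) (n r : ℕ) → 1 ≤ n → 1 ≤ r →
    (P : Poly.Polymatroid 𝔽 n r) →
    ∀ (X₁ X₂ X₃ X₄ : ℤ) →
    Poly.RGF 𝔽 n r (Poly.dualρ 𝔽 n r (Poly.Polymatroid.ρ P)) X₁ X₂ X₃ X₄
      ≡ Poly.RGFhat 𝔽 n r (Poly.Polymatroid.ρ P) X₂ X₁ X₃ X₄
theorem2p6 𝔽 n r _ _ P X₁ X₂ X₃ X₄ = begin
  ∑ (λ D → f (dualρ ρ) D X₁ X₂ ℤ.* g (dim D) X₃ X₄) ΣE ≡⟨ ∑-cong ΣE (λ D∈ → cong₂ ℤ._*_ (f-dual (ΣE⁻ D∈) X₁ X₂) (g-⊥⊥ D∈)) ⟩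
  ∑ (R̂-term ∘ _⊥) ΣE                                   ≡⟨ ∑-map R̂-term _⊥ ΣE ⟨
  ∑ R̂-term (map _⊥ ΣE)                                 ≡⟨ ∑-↭ R̂-term ⊥-permutes-ΣE ⟩
  ∑ R̂-term ΣE                                          ∎
  where
  open Poly 𝔽 n r using (SubE; ΣE; _⊥; dim; dualρ; f; g)
  open Poly.Polymatroid P using (ρ)
  open Subspaces 𝔽 n r using (ΣE⁻; ⊥-involutive; ⊥-permutes-ΣE)
  open PolymatroidDuality 𝔽 n r P using (f-dual)
  open ℤ-Sum using (∑; ∑-cong; ∑-map; ∑-↭)
  open ≡-Reasoning
  R̂-term : SubE → ℤ
  R̂-term J = f ρ J X₂ X₁ ℤ.* g (dim (J ⊥)) X₃ X₄
  g-⊥⊥ : ∀ {D} → D ∈ ΣE → g (dim D) X₃ X₄ ≡ g (dim (D ⊥ ⊥)) X₃ X₄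
  g-⊥⊥ D∈ = cong (λ E → g (dim E) X₃ X₄) (sym (⊥-involutive (ΣE⁻ D∈)))
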